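{- Let $h\geq 2$ and let $\vec c=[c_1,\ldots,c_h]$ be an $h$-feasible color sequence with $2<c_1\leq c_2\leq\cdots\leq c_h$. Define integers $a_2,\ldots,a_h$ and $b_2,\ldots,b_h$ by $a_2=c_2-1$ and $b_2=c_1-1$; if $h\geq 3$, $$a_3=\left\lceil \frac{c_3+c_1-c_2}{2}\right\rceil,\qquad b_3=c_2-c_1+\left\lfloor\frac{c_3+c_1-c_2}{2}\right\rfloor;$$ and for $i=4,5,\ldots,h$: if $\sum_{j=2}^{i-1}a_j<\sum_{j=2}^{i-1}b_j$ then $a_i=\lceil c_i/2\rceil$ and $b_i=\lfloor c_i/2\rfloor$; otherwise $a_i=\lfloor c_i/2\rfloor$ and $b_i=\lceil c_i/2\rceil$. Then the sequences $(a_2,\ldots,a_h)$ and $(b_2,\ldots,b_h)$, after being sorted in non-decreasing order and regarded as sequences of length $h-1$, are both $(h-1)$-feasible color sequences.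
   Context: A color sequence of dimension $d$ is a non-decreasing sequence of positive integers $x_1\leq\cdots\leq x_d$. It is $d$-feasible if (C1) $\sum_{i=1}^{\ell}x_i\geq\sum_{i=1}^{\ell}2^i$ for every $1\leq\ell\leq d$, and (C2) $\sum_{i=1}^{d}x_i=\sum_{i=1}^{d}2^i=2^{d+1}-2$. -}

module Defs where

open import Data.Nat using (ℕ; zero; suc; _+_; _∸_; _^_; _≤_; _<_; _<ᵇ_; ⌊_/2⌋; ⌈_/2⌉)
open import Data.Nat.Properties using (≤-decTotalOrder)
open import Data.List using (List; []; _∷_; length; take; map)
open import Data.Nat.ListAction using (sum)
open import Relation.Binary.PropositionalEquality using (_≡_)
open import Data.List.Relation.Unary.All using (All)
open import Data.List.Relation.Unary.Linked using (Linked)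
open import Data.Product using (_×_; _,_; proj₁; proj₂)
open import Data.Bool using (if_then_else_)

open import Data.List.Sort ≤-decTotalOrder public using (sort)

twoSum : ℕ → ℕ
twoSum zero = zero
twoSum (suc l) = twoSum l + 2 ^ suc l

ColorSeq : ℕ → List ℕ → Set
ColorSeq d xs = (length xs ≡ d) × Linked _≤_ xs × All (λ x → 1 ≤ x) xs

-- d-feasible color sequence: (C1) and (C2)
Feasible : ℕ → List ℕ → Set
Feasible d xs =
  ColorSeq d xs
  × (∀ ℓ → 1 ≤ ℓ → ℓ ≤ d → twoSum ℓ ≤ sum (take ℓ xs))
  × (sum xs ≡ twoSum d)

-- pairs (a_i , b_i) for i ≥ 4, given running sums sa = Σ_{j<i} a_j, sb = Σ_{j<i} b_j
abTail : ℕ → ℕ → List ℕ → List (ℕ × ℕ)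
abTail sa sb [] = []
abTail sa sb (x ∷ xs) =
  if sa <ᵇ sb
  then (⌈ x /2⌉ , ⌊ x /2⌋) ∷ abTail (sa + ⌈ x /2⌉) (sb + ⌊ x /2⌋) xs
  else (⌊ x /2⌋ , ⌈ x /2⌉) ∷ abTail (sa + ⌊ x /2⌋) (sb + ⌈ x /2⌉) xs

-- the list [(a_2,b_2), ..., (a_h,b_h)] for c = [c_1, c_2, c_3, ...]
-- (subtractions are exact for non-decreasing c, since c_3 ≥ c_2 ≥ c_1)
abPairs : ℕ → ℕ → List ℕ → List (ℕ × ℕ)
abPairs c1 c2 [] = (c2 ∸ 1 , c1 ∸ 1) ∷ []
abPairs c1 c2 (c3 ∷ rest) =
  (a2 , b2) ∷ (a3 , b3) ∷ abTail (a2 + a3) (b2 + b3) rest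
  where
  a2 = c2 ∸ 1
  b2 = c1 ∸ 1
  a3 = ⌈ (c3 + c1 ∸ c2) /2⌉
  b3 = (c2 ∸ c1) + ⌊ (c3 + c1 ∸ c2) /2⌋

aSeq : ℕ → ℕ → List ℕ → List ℕ
aSeq c1 c2 rest = map proj₁ (abPairs c1 c2 rest)

bSeq : ℕ → ℕ → List ℕ → List ℕ
bSeq c1 c2 rest = map proj₂ (abPairs c1 c2 rest)

{-# OPTIONS --safe #-}
-- For any list s and threshold U, the ℓ smallest entries of s sum to at least ℓ·U − Σ_{x ∈ s} (U ∸ x),
-- so (C1) for the sorted sequences follows from the order-free bound Σ (2^ℓ ∸ x) + (2^{ℓ+1} − 2) ≤ ℓ·2^ℓ.
-- Besides the heads a₂, a₃ and b₂, b₃, every a_i and b_i is a half of c_i, and the greedy rule keeps the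
-- running sums of a and b within one of each other; as the four heads sum to c₁ + c₂ + c₃ − 2, (C2) for c
-- splits evenly into (C2) for a and for b.  For the bound at U = 2^ℓ let n count the c_i (i ≥ 4) below 2U:
-- the larger c_i have both halves ≥ U and cost nothing, the n smaller ones cost nU minus their halves,
-- which balance turns into roughly half of c₄ + ⋯ + c_{3+n}.  What remains compares powers of two with
-- c₁ + ⋯ + c_{3+n}, and is settled by (C1) for c at index 3 + n.

module Submission where

open import Defs
open import Data.Nat using (ℕ; zero; suc; _+_; _*_; _∸_; _^_; _≤_; _<_; _≤?_; _<ᵇ_; ⌊_/2⌋; ⌈_/2⌉; z≤n; s≤s)
open import Data.Nat.Properties
open import Data.Nat.Tactic.RingSolver using (solve; solve-∀)
open import Data.List using ([]; _∷_)
open import Data.Product using (_×_; _,_; proj₁; proj₂; swap; Σ-syntax)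
open import Data.Sum using (_⊎_; inj₁; inj₂)
open import Relation.Nullary using (Dec; yes; no)
open import Relation.Binary.PropositionalEquality
  using (_≡_; refl; sym; trans; cong; cong₂; subst; subst₂; module ≡-Reasoning)
open import Algebra.Properties.CommutativeSemigroup +-commutativeSemigroup using (interchange)

-- Halves, balance and powers of two

⌈n/2⌉≤1+⌊n/2⌋ : ∀ n → ⌈ n /2⌉ ≤ suc ⌊ n /2⌋
⌈n/2⌉≤1+⌊n/2⌋ n = ⌊n/2⌋-mono (n≤1+n (suc n))

n<2*m⇒⌈n/2⌉≤m : ∀ {m n} → n < 2 * m → ⌈ n /2⌉ ≤ m
n<2*m⇒⌈n/2⌉≤m {m} {n} n<2m = subst (⌈ n /2⌉ ≤_) (sym (n≡⌊n+n/2⌋ m))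
  (⌊n/2⌋-mono (subst (suc n ≤_) (cong (m +_) (+-identityʳ m)) n<2m))

2*m≤n⇒m≤⌊n/2⌋ : ∀ {m n} → 2 * m ≤ n → m ≤ ⌊ n /2⌋
2*m≤n⇒m≤⌊n/2⌋ {m} {n} 2m≤n = subst (_≤ ⌊ n /2⌋) (sym (n≡⌊n+n/2⌋ m))
  (⌊n/2⌋-mono (subst (_≤ n) (cong (m +_) (+-identityʳ m)) 2m≤n))

2*m≤1+2*n⇒m≤n : ∀ {m n} → 2 * m ≤ suc (2 * n) → m ≤ n
2*m≤1+2*n⇒m≤n {m} {n} 2m≤1+2n = ≮⇒≥ λ n<m →
  1+n≰n (≤-trans (subst (_≤ 2 * m) (*-suc 2 n) (*-monoʳ-≤ 2 n<m)) 2m≤1+2n)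

m∸n+n≡m+[n∸m] : ∀ m n → (m ∸ n) + n ≡ m + (n ∸ m)
m∸n+n≡m+[n∸m] zero    zero    = refl
m∸n+n≡m+[n∸m] zero    (suc n) = refl
m∸n+n≡m+[n∸m] (suc m) zero    = refl
m∸n+n≡m+[n∸m] (suc m) (suc n) = trans (+-suc (m ∸ n) n) (cong suc (m∸n+n≡m+[n∸m] m n))

Balanced : ℕ → ℕ → Set
Balanced x y = x ≤ suc y × y ≤ suc x

balanced-step : ∀ {x y} c → y ≤ x → x ≤ suc y → Balanced (x + ⌊ c /2⌋) (y + ⌈ c /2⌉)
balanced-step {x} {y} c y≤x x≤1+y =
  +-mono-≤ x≤1+y (⌊n/2⌋≤⌈n/2⌉ c) ,
  ≤-trans (+-mono-≤ y≤x (⌈n/2⌉≤1+⌊n/2⌋ c)) (≤-reflexive (+-suc x ⌊ c /2⌋))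

balanced-halves : ∀ {x y m} → Balanced x y → x + y ≡ 2 * m → x ≡ m × y ≡ m
balanced-halves {x} {y} {m} (x≤1+y , y≤1+x) x+y≡2m =
  ≡m x≤1+y y≤1+x x+y≡2m , ≡m y≤1+x x≤1+y (trans (+-comm y x) x+y≡2m)
  where
  open ≤-Reasoning
  ≤m : ∀ {u v} → u ≤ suc v → u + v ≡ 2 * m → u ≤ m
  ≤m {u} {v} u≤1+v u+v≡2m = 2*m≤1+2*n⇒m≤n (begin
    2 * u        ≡⟨ solve (u ∷ []) ⟩
    u + u        ≤⟨ +-monoʳ-≤ u u≤1+v ⟩
    u + suc v    ≡⟨ +-suc u v ⟩
    suc (u + v)  ≡⟨ cong suc u+v≡2m ⟩
    suc (2 * m)  ∎)
  ≡m : ∀ {u v} → u ≤ suc v → v ≤ suc u → u + v ≡ 2 * m → u ≡ m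
  ≡m {u} {v} u≤1+v v≤1+u u+v≡2m = ≤-antisym (≤m u≤1+v u+v≡2m) (+-cancelʳ-≤ m m u (begin
    m + m  ≡⟨ solve (m ∷ []) ⟩
    2 * m  ≡⟨ sym u+v≡2m ⟩
    u + v  ≤⟨ +-monoʳ-≤ u (≤m v≤1+u (trans (+-comm v u) u+v≡2m)) ⟩
    u + m  ∎))

twoSum+2 : ∀ ℓ → twoSum ℓ + 2 ≡ 2 * 2 ^ ℓ
twoSum+2 zero    = refl
twoSum+2 (suc ℓ) = begin
  twoSum ℓ + 2 * 2 ^ ℓ + 2    ≡⟨ +-assoc (twoSum ℓ) _ 2 ⟩
  twoSum ℓ + (2 * 2 ^ ℓ + 2)  ≡⟨ cong (twoSum ℓ +_) (+-comm (2 * 2 ^ ℓ) 2) ⟩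
  twoSum ℓ + (2 + 2 * 2 ^ ℓ)  ≡⟨ sym (+-assoc (twoSum ℓ) 2 _) ⟩
  twoSum ℓ + 2 + 2 * 2 ^ ℓ    ≡⟨ cong (_+ 2 * 2 ^ ℓ) (twoSum+2 ℓ) ⟩
  2 * 2 ^ ℓ + 2 * 2 ^ ℓ       ≡⟨ cong (2 * 2 ^ ℓ +_) (sym (+-identityʳ _)) ⟩
  2 * (2 * 2 ^ ℓ)             ∎
  where open ≡-Reasoning

twoSum-suc : ∀ k → twoSum (suc k) ≡ 2 * twoSum k + 2
twoSum-suc k = begin
  twoSum k + 2 * 2 ^ k       ≡⟨ cong (twoSum k +_) (sym (twoSum+2 k)) ⟩
  twoSum k + (twoSum k + 2)  ≡⟨ double (twoSum k) ⟩
  2 * twoSum k + 2           ∎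
  where
  open ≡-Reasoning
  double : ∀ a → a + (a + 2) ≡ 2 * a + 2
  double = solve-∀

m≤2^n⇒1+m≤2^[1+n] : ∀ {m} n → m ≤ 2 ^ n → suc m ≤ 2 ^ suc n
m≤2^n⇒1+m≤2^[1+n] n m≤2^n = ≤-trans (+-mono-≤ (m^n>0 2 n) m≤2^n)
  (≤-reflexive (cong (2 ^ n +_) (sym (+-identityʳ (2 ^ n)))))

1+n≤2^n : ∀ n → suc n ≤ 2 ^ n
1+n≤2^n zero    = ≤-refl
1+n≤2^n (suc n) = m≤2^n⇒1+m≤2^[1+n] n (1+n≤2^n n)

2+n≤2^n : ∀ n → 2 ≤ n → 2 + n ≤ 2 ^ n
2+n≤2^n 1                   (s≤s ())
2+n≤2^n 2                   _ = ≤-refl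
2+n≤2^n (suc n@(suc (suc _))) _ = m≤2^n⇒1+m≤2^[1+n] n (2+n≤2^n n (s≤s (s≤s z≤n)))

[ℓ+m]*2^ℓ≤2^[ℓ+j]+ℓ*2^ℓ : ∀ ℓ j {m} → m ≤ 2 ^ j → (ℓ + m) * 2 ^ ℓ ≤ 2 ^ (ℓ + j) + ℓ * 2 ^ ℓ
[ℓ+m]*2^ℓ≤2^[ℓ+j]+ℓ*2^ℓ ℓ j {m} m≤2^j = begin
  (ℓ + m) * 2 ^ ℓ              ≡⟨ trans (*-distribʳ-+ (2 ^ ℓ) ℓ m) (+-comm (ℓ * 2 ^ ℓ) _) ⟩
  m * 2 ^ ℓ + ℓ * 2 ^ ℓ        ≤⟨ +-monoˡ-≤ (ℓ * 2 ^ ℓ) (*-monoˡ-≤ (2 ^ ℓ) m≤2^j) ⟩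
  2 ^ j * 2 ^ ℓ + ℓ * 2 ^ ℓ    ≡⟨ cong (_+ ℓ * 2 ^ ℓ) (trans (*-comm (2 ^ j) _) (sym (^-distribˡ-+-* 2 ℓ j))) ⟩
  2 ^ (ℓ + j) + ℓ * 2 ^ ℓ      ∎
  where open ≤-Reasoning

[1+k]*2^ℓ≤2^k+ℓ*2^ℓ : ∀ ℓ k → suc k * 2 ^ ℓ ≤ 2 ^ k + ℓ * 2 ^ ℓ
[1+k]*2^ℓ≤2^k+ℓ*2^ℓ ℓ k with ℓ ≤? k
... | no ℓ≰k = ≤-trans (*-monoˡ-≤ (2 ^ ℓ) (≰⇒> ℓ≰k)) (m≤n+m (ℓ * 2 ^ ℓ) (2 ^ k))
... | yes ℓ≤k with m≤n⇒∃[o]m+o≡n ℓ≤k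
...   | j , refl = subst (λ i → i * 2 ^ ℓ ≤ 2 ^ (ℓ + j) + ℓ * 2 ^ ℓ) (+-suc ℓ j)
  ([ℓ+m]*2^ℓ≤2^[ℓ+j]+ℓ*2^ℓ ℓ j (1+n≤2^n j))

[2+k]*2^ℓ≤2^k+ℓ*2^ℓ : ∀ ℓ k → 2 + ℓ ≤ k → (2 + k) * 2 ^ ℓ ≤ 2 ^ k + ℓ * 2 ^ ℓ
[2+k]*2^ℓ≤2^k+ℓ*2^ℓ ℓ k 2+ℓ≤k with m≤n⇒∃[o]m+o≡n (≤-trans (m≤n+m ℓ 2) 2+ℓ≤k)
... | j , refl = subst (λ i → i * 2 ^ ℓ ≤ 2 ^ (ℓ + j) + ℓ * 2 ^ ℓ) reindex
  ([ℓ+m]*2^ℓ≤2^[ℓ+j]+ℓ*2^ℓ ℓ j (2+n≤2^n j 2≤j))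
  where
  reindex : ℓ + (2 + j) ≡ 2 + (ℓ + j)
  reindex = solve (ℓ ∷ j ∷ [])
  2≤j : 2 ≤ j
  2≤j = +-cancelˡ-≤ ℓ 2 j (subst (_≤ ℓ + j) (+-comm 2 ℓ) 2+ℓ≤k)

-- Inequalities behind the threshold bound

-- P plays the role of c₁ + ⋯ + c_{3+n}, so that (C1) at index 3 + n reads 2 * 2 ^ (3 + n) ≤ P + 2.
main-inequality : ∀ ℓ n {E P} → E ≤ 2 * 2 ^ ℓ → 2 * 2 ^ (3 + n) ≤ P + 2 →
  (2 + n ≤ ℓ → 2 * 2 ^ (3 + n) + E ≤ P + 2) →
  2 * ((4 + n) * 2 ^ ℓ) + E ≤ 2 * (ℓ * 2 ^ ℓ) + (P + 2)
main-inequality ℓ n {E} {P} E≤2U W≤P+2 W+E≤P+2 with 2 + n ≤? ℓ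
... | yes 2+n≤ℓ = begin
  2 * ((4 + n) * U) + E       ≤⟨ +-monoˡ-≤ E (*-monoʳ-≤ 2 ([1+k]*2^ℓ≤2^k+ℓ*2^ℓ ℓ (3 + n))) ⟩
  2 * (W + ℓ * U) + E         ≡⟨ regroup W (ℓ * U) E ⟩
  2 * (ℓ * U) + (2 * W + E)   ≤⟨ +-monoʳ-≤ (2 * (ℓ * U)) (W+E≤P+2 2+n≤ℓ) ⟩
  2 * (ℓ * U) + (P + 2)       ∎
  where
  open ≤-Reasoning
  U W : ℕ
  U = 2 ^ ℓ
  W = 2 ^ (3 + n)
  regroup : ∀ a b c → 2 * (a + b) + c ≡ 2 * b + (2 * a + c)
  regroup = solve-∀
... | no 2+n≰ℓ = begin
  2 * ((4 + n) * U) + E       ≤⟨ +-monoʳ-≤ (2 * ((4 + n) * U)) E≤2U ⟩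
  2 * ((4 + n) * U) + 2 * U   ≡⟨ trans (sym (*-distribˡ-+ 2 ((4 + n) * U) U)) (cong (2 *_) (+-comm _ U)) ⟩
  2 * ((5 + n) * U)           ≤⟨ *-monoʳ-≤ 2 ([2+k]*2^ℓ≤2^k+ℓ*2^ℓ ℓ (3 + n) (s≤s (≰⇒> 2+n≰ℓ))) ⟩
  2 * (W + ℓ * U)             ≡⟨ trans (*-distribˡ-+ 2 W _) (+-comm (2 * W) _) ⟩
  2 * (ℓ * U) + 2 * W         ≤⟨ +-monoʳ-≤ (2 * (ℓ * U)) W≤P+2 ⟩
  2 * (ℓ * U) + (P + 2)       ∎
  where
  open ≤-Reasoning
  U W : ℕ
  U = 2 ^ ℓ
  W = 2 ^ (3 + n)

2*2^[2+n]≤7+n*[2^[2+n]+1] : ∀ n → 1 ≤ n → 2 * 2 ^ (2 + n) ≤ 7 + n * (2 ^ (2 + n) + 1)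
2*2^[2+n]≤7+n*[2^[2+n]+1] 1             _ = ≤-refl
2*2^[2+n]≤7+n*[2^[2+n]+1] (suc (suc m)) _ = ≤-trans (*-monoʳ-≤ 2 (m≤m+n V 1))
  (≤-trans (*-monoˡ-≤ (V + 1) (m≤m+n 2 m)) (m≤n+m _ 7))
  where
  V : ℕ
  V = 2 ^ (4 + m)

excess-dichotomy : ∀ U {x y K} → 2 * x + 2 ≤ K → 2 * y + 2 ≤ K → 2 * (x + y) + 2 ≤ K + 2 * U →
  2 * ((x ∸ U) + (y ∸ U)) ≡ 0 ⊎ 2 * ((x ∸ U) + (y ∸ U)) + 2 * U + 2 ≤ K
excess-dichotomy U {x} {y} {K} 2x+2≤K 2y+2≤K 2[x+y]+2≤K+2U with x ≤? U | y ≤? U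
... | yes x≤U | yes y≤U = inj₁ (cong (2 *_) (cong₂ _+_ (m≤n⇒m∸n≡0 x≤U) (m≤n⇒m∸n≡0 y≤U)))
... | no x≰U | yes y≤U with m≤n⇒∃[o]m+o≡n (<⇒≤ (≰⇒> x≰U))
...   | p , refl rewrite m+n∸m≡n U p | m≤n⇒m∸n≡0 y≤U = inj₂ (begin
  2 * (p + 0) + 2 * U + 2  ≡⟨ solve (p ∷ U ∷ []) ⟩
  2 * (U + p) + 2          ≤⟨ 2x+2≤K ⟩
  K                        ∎)
  where open ≤-Reasoning
excess-dichotomy U {x} {y} {K} 2x+2≤K 2y+2≤K 2[x+y]+2≤K+2U | yes x≤U | no y≰U
  with m≤n⇒∃[o]m+o≡n (<⇒≤ (≰⇒> y≰U))
...   | q , refl rewrite m+n∸m≡n U q | m≤n⇒m∸n≡0 x≤U = inj₂ (begin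
  2 * (0 + q) + 2 * U + 2  ≡⟨ solve (q ∷ U ∷ []) ⟩
  2 * (U + q) + 2          ≤⟨ 2y+2≤K ⟩
  K                        ∎)
  where open ≤-Reasoning
excess-dichotomy U {x} {y} {K} 2x+2≤K 2y+2≤K 2[x+y]+2≤K+2U | no x≰U | no y≰U
  with m≤n⇒∃[o]m+o≡n (<⇒≤ (≰⇒> x≰U)) | m≤n⇒∃[o]m+o≡n (<⇒≤ (≰⇒> y≰U))
...   | p , refl | q , refl rewrite m+n∸m≡n U p | m+n∸m≡n U q =
  inj₂ (+-cancelʳ-≤ (2 * U) _ K (begin
  2 * (p + q) + 2 * U + 2 + 2 * U  ≡⟨ solve (p ∷ q ∷ U ∷ []) ⟩
  2 * (U + p + (U + q)) + 2        ≤⟨ 2[x+y]+2≤K+2U ⟩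
  K + 2 * U                        ∎))
  where open ≤-Reasoning

excess≤2U : ∀ {E U c₂ c₃} → E ≡ 0 ⊎ E + 2 * U + 2 ≤ c₂ + c₃ → c₂ ≤ c₃ → c₃ < 2 * U → E ≤ 2 * U
excess≤2U (inj₁ refl) _ _ = z≤n
excess≤2U {E} {U} {c₂} {c₃} (inj₂ E+2U+2≤K) c₂≤c₃ c₃<2U = +-cancelʳ-≤ (2 * U + 2) E (2 * U) (begin
  E + (2 * U + 2)          ≡⟨ sym (+-assoc E _ 2) ⟩
  E + 2 * U + 2            ≤⟨ E+2U+2≤K ⟩
  c₂ + c₃                  ≤⟨ +-monoˡ-≤ c₃ c₂≤c₃ ⟩
  c₃ + c₃                  ≤⟨ +-mono-≤ (n≤1+n c₃) (n≤1+n c₃) ⟩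
  suc c₃ + suc c₃          ≤⟨ +-mono-≤ c₃<2U c₃<2U ⟩
  2 * U + 2 * U            ≤⟨ +-monoʳ-≤ (2 * U) (m≤m+n (2 * U) 2) ⟩
  2 * U + (2 * U + 2)      ∎)
  where open ≤-Reasoning

excess-within-power : ∀ {n V U E c₁ c₂ c₃ Sg} → 2 * V ≤ 7 + n * (V + 1) → V ≤ U → 3 ≤ c₁ →
  c₂ ≤ c₃ → n * c₃ ≤ Sg → E + 2 * U + 2 ≤ c₂ + c₃ → 2 * (2 * V) + E ≤ c₁ + (c₂ + (c₃ + Sg)) + 2
excess-within-power {n} {V} {U} {E} {c₁} {c₂} {c₃} {Sg} 2V≤ V≤U 3≤c₁ c₂≤c₃ nc₃≤Sg E+2U+2≤K =
  +-cancelʳ-≤ (2 * U + 2) _ _ (begin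
    2 * (2 * V) + E + (2 * U + 2)              ≡⟨ solve (V ∷ E ∷ U ∷ []) ⟩
    2 * V + 2 * V + (E + 2 * U + 2)            ≤⟨ +-mono-≤ (+-mono-≤ (*-monoʳ-≤ 2 V≤U) 2V≤) E+2U+2≤K ⟩
    2 * U + (7 + n * (V + 1)) + (c₂ + c₃)      ≤⟨ +-monoˡ-≤ (c₂ + c₃) (+-monoʳ-≤ (2 * U) tail≤) ⟩
    2 * U + (c₁ + 4 + Sg) + (c₂ + c₃)          ≡⟨ solve (U ∷ c₁ ∷ Sg ∷ c₂ ∷ c₃ ∷ []) ⟩
    c₁ + (c₂ + (c₃ + Sg)) + 2 + (2 * U + 2)    ∎)
  where
  open ≤-Reasoning
  U+1≤c₃ : U + 1 ≤ c₃
  U+1≤c₃ = *-cancelˡ-≤ 2 (begin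
    2 * (U + 1)      ≡⟨ solve (U ∷ []) ⟩
    0 + 2 * U + 2    ≤⟨ +-monoˡ-≤ 2 (+-monoˡ-≤ (2 * U) (z≤n {E})) ⟩
    E + 2 * U + 2    ≤⟨ E+2U+2≤K ⟩
    c₂ + c₃          ≤⟨ +-monoˡ-≤ c₃ c₂≤c₃ ⟩
    c₃ + c₃          ≡⟨ solve (c₃ ∷ []) ⟩
    2 * c₃           ∎)
  tail≤ : 7 + n * (V + 1) ≤ c₁ + 4 + Sg
  tail≤ = +-mono-≤ (+-monoˡ-≤ 4 3≤c₁)
    (≤-trans (*-monoʳ-≤ n (+-monoˡ-≤ 1 V≤U)) (≤-trans (*-monoʳ-≤ n U+1≤c₃) nc₃≤Sg))

pair-deficit : ∀ {U x y} → 4 ≤ U → 2 ≤ x → 2 ≤ y → 6 ≤ x + y → (U ∸ x) + (U ∸ y) + 6 ≤ 2 * U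
pair-deficit {U} {x} {y} 4≤U 2≤x 2≤y 6≤x+y = cases (x ≤? U) (y ≤? U)
  where
  open ≤-Reasoning
  U+U≡2*U : U + U ≡ 2 * U
  U+U≡2*U = cong (U +_) (sym (+-identityʳ U))
  deficit : ∀ {z} → 2 ≤ z → (U ∸ z) + 2 ≤ U
  deficit 2≤z = ≤-trans (+-monoˡ-≤ 2 (∸-monoʳ-≤ U 2≤z))
    (≤-reflexive (m∸n+n≡m (≤-trans (s≤s (s≤s z≤n)) 4≤U)))
  one-exceeds : ∀ {v} → v + 2 ≤ U → v + 6 ≤ 2 * U
  one-exceeds {v} v+2≤U = begin
    v + 6        ≡⟨ sym (+-assoc v 2 4) ⟩
    v + 2 + 4    ≤⟨ +-mono-≤ v+2≤U 4≤U ⟩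
    U + U        ≡⟨ U+U≡2*U ⟩
    2 * U        ∎
  cases : Dec (x ≤ U) → Dec (y ≤ U) → (U ∸ x) + (U ∸ y) + 6 ≤ 2 * U
  cases (yes x≤U) (yes y≤U) = begin
    (U ∸ x) + (U ∸ y) + 6         ≤⟨ +-monoʳ-≤ _ 6≤x+y ⟩
    (U ∸ x) + (U ∸ y) + (x + y)   ≡⟨ interchange (U ∸ x) (U ∸ y) x y ⟩
    (U ∸ x + x) + (U ∸ y + y)     ≡⟨ cong₂ _+_ (m∸n+n≡m x≤U) (m∸n+n≡m y≤U) ⟩
    U + U                         ≡⟨ U+U≡2*U ⟩
    2 * U                         ∎
  cases (no x≰U) _ = subst (λ u → u + (U ∸ y) + 6 ≤ 2 * U) (sym (m≤n⇒m∸n≡0 (<⇒≤ (≰⇒> x≰U))))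
    (one-exceeds (deficit 2≤y))
  cases _ (no y≰U) = subst (λ v → (U ∸ x) + v + 6 ≤ 2 * U) (sym (m≤n⇒m∸n≡0 (<⇒≤ (≰⇒> y≰U))))
    (subst (λ s → s + 6 ≤ 2 * U) (sym (+-identityʳ (U ∸ x))) (one-exceeds (deficit 2≤x)))

pair-shortfall : ∀ ℓ {x y} → 1 ≤ ℓ → 2 ≤ x → 2 ≤ y → 6 ≤ x + y →
  (2 ^ ℓ ∸ x) + (2 ^ ℓ ∸ y) + twoSum ℓ ≤ ℓ * 2 ^ ℓ
pair-shortfall 1 _ 2≤x 2≤y _ = ≤-reflexive (cong (_+ 2) (cong₂ _+_ (m≤n⇒m∸n≡0 2≤x) (m≤n⇒m∸n≡0 2≤y)))
pair-shortfall ℓ@(suc (suc _)) {x} {y} _ 2≤x 2≤y 6≤x+y =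
  combine {2 ^ ℓ} (2 ^ ℓ ∸ x) (2 ^ ℓ ∸ y)
    (pair-deficit (^-monoʳ-≤ 2 {2} {ℓ} (s≤s (s≤s z≤n))) 2≤x 2≤y 6≤x+y) (twoSum+2 ℓ) ([1+k]*2^ℓ≤2^k+ℓ*2^ℓ ℓ 3)
  where
  combine : ∀ {U L τ} u v → u + v + 6 ≤ 2 * U → τ + 2 ≡ 2 * U → 4 * U ≤ 8 + L → u + v + τ ≤ L
  combine {U} {L} {τ} u v u+v+6≤2U τ+2≡2U 4U≤8+L = +-cancelʳ-≤ 8 _ _ (begin
    u + v + τ + 8          ≡⟨ solve (u ∷ v ∷ τ ∷ []) ⟩
    (u + v + 6) + (τ + 2)  ≤⟨ +-mono-≤ u+v+6≤2U (≤-reflexive τ+2≡2U) ⟩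
    2 * U + 2 * U          ≡⟨ solve (U ∷ []) ⟩
    4 * U                  ≤⟨ 4U≤8+L ⟩
    8 + L                  ≡⟨ +-comm 8 L ⟩
    L + 8                  ∎)
    where open ≤-Reasoning

14≤s+T+2⇒6≤s : ∀ {s T C} → T ≤ suc s → s + T + 2 ≡ C → 14 ≤ C → 6 ≤ s
14≤s+T+2⇒6≤s T≤1+s refl 14≤C = ≮⇒≥ λ s<6 →
  1+n≰n (≤-trans 14≤C (+-monoˡ-≤ 2 (+-mono-≤ (≤-pred s<6) (≤-trans T≤1+s s<6))))

2*s+2≤c₂+c₃+2*U : ∀ {s T c₁ c₂ c₃ U} → s ≤ suc T → s + T + 2 ≡ c₁ + (c₂ + c₃) → c₁ < 2 * U →
  2 * s + 2 ≤ c₂ + c₃ + 2 * U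
2*s+2≤c₂+c₃+2*U {s} {T} {c₁} {c₂} {c₃} {U} s≤1+T s+T+2≡C c₁<2U = begin
  2 * s + 2                ≡⟨ solve (s ∷ []) ⟩
  s + s + 2                ≤⟨ +-monoˡ-≤ 2 (+-monoʳ-≤ s s≤1+T) ⟩
  s + suc T + 2            ≡⟨ solve (s ∷ T ∷ []) ⟩
  suc (s + T + 2)          ≡⟨ cong suc s+T+2≡C ⟩
  suc c₁ + (c₂ + c₃)       ≤⟨ +-monoˡ-≤ (c₂ + c₃) c₁<2U ⟩
  2 * U + (c₂ + c₃)        ≡⟨ +-comm (2 * U) _ ⟩
  c₂ + c₃ + 2 * U          ∎
  where open ≤-Reasoning

doubled-tail-bound : ∀ F A B {N Sg S T} → F + A ≡ N → A + B ≡ Sg → T + B ≤ suc (S + A) →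
  2 * F + Sg + T ≤ 2 * N + S + 1
doubled-tail-bound F A B {S = S} {T} refl refl T+B≤1+S+A = begin
  2 * F + (A + B) + T       ≡⟨ solve (F ∷ A ∷ B ∷ T ∷ []) ⟩
  2 * F + A + (T + B)       ≤⟨ +-monoʳ-≤ (2 * F + A) T+B≤1+S+A ⟩
  2 * F + A + suc (S + A)   ≡⟨ solve (F ∷ A ∷ S ∷ []) ⟩
  2 * (F + A) + S + 1       ∎
  where open ≤-Reasoning

shortfall+twoSum≤ℓ*U : ∀ {ℓ n U x y u v F p q T Sg P τ} →
  u + x ≡ U + p → v + y ≡ U + q → τ + 2 ≡ 2 * U → x + y + T + 2 + Sg ≡ P →
  2 * F + Sg + T ≤ 2 * (n * U) + (x + y) + 1 →
  2 * ((4 + n) * U) + 2 * (p + q) ≤ 2 * (ℓ * U) + (P + 2) →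
  u + (v + F) + τ ≤ ℓ * U
shortfall+twoSum≤ℓ*U {ℓ} {n} {U} {x} {y} {u} {v} {F} {p} {q} {T} {Sg} {τ = τ} u+x≡ v+y≡ τ+2≡ refl tail main =
  2*m≤1+2*n⇒m≤n (+-cancelʳ-≤ (2 * (x + y) + Sg + T + 4) _ _ (begin
    2 * (u + (v + F) + τ) + (2 * (x + y) + Sg + T + 4)
      ≡⟨ solve (u ∷ v ∷ F ∷ τ ∷ x ∷ y ∷ Sg ∷ T ∷ []) ⟩
    2 * (u + x) + 2 * (v + y) + (2 * F + Sg + T) + 2 * (τ + 2)
      ≡⟨ cong₂ (λ a b → 2 * a + 2 * b + (2 * F + Sg + T) + 2 * (τ + 2)) u+x≡ v+y≡ ⟩
    2 * (U + p) + 2 * (U + q) + (2 * F + Sg + T) + 2 * (τ + 2)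
      ≡⟨ cong (λ c → 2 * (U + p) + 2 * (U + q) + (2 * F + Sg + T) + 2 * c) τ+2≡ ⟩
    2 * (U + p) + 2 * (U + q) + (2 * F + Sg + T) + 2 * (2 * U)
      ≤⟨ +-monoˡ-≤ (2 * (2 * U)) (+-monoʳ-≤ (2 * (U + p) + 2 * (U + q)) tail) ⟩
    2 * (U + p) + 2 * (U + q) + (2 * (n * U) + (x + y) + 1) + 2 * (2 * U)
      ≡⟨ solve (U ∷ p ∷ q ∷ n ∷ x ∷ y ∷ []) ⟩
    2 * ((4 + n) * U) + 2 * (p + q) + (x + y + 1)
      ≤⟨ +-monoˡ-≤ (x + y + 1) main ⟩
    2 * (ℓ * U) + (x + y + T + 2 + Sg + 2) + (x + y + 1)
      ≡⟨ solve (ℓ ∷ U ∷ x ∷ y ∷ T ∷ Sg ∷ []) ⟩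
    suc (2 * (ℓ * U)) + (2 * (x + y) + Sg + T + 4)
      ∎))
  where open ≤-Reasoning

Head : ℕ → ℕ → Set
Head K x = 2 ≤ x × 2 * x + 2 ≤ K

-- With c₁ = 1 + b, c₂ = c₁ + d, c₃ = c₂ + e and h, H the two halves of c₃ + c₁ − c₂ = c₁ + e,
-- the heads are a₂ = b + d, a₃ = H, b₂ = b and b₃ = d + h.
module Heads {b d e h H : ℕ} (2≤b : 2 ≤ b) (h+H≡1+b+e : h + H ≡ suc b + e) (h≤H : h ≤ H) (H≤1+h : H ≤ suc h)
             (14≤C : 14 ≤ suc b + (suc b + d + (suc b + d + e))) where

  open ≤-Reasoning

  K : ℕ
  K = suc b + d + (suc b + d + e)

  heads-sum : b + d + H + (b + (d + h)) + 2 ≡ suc b + (suc b + d + (suc b + d + e))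
  heads-sum = begin-equality
    b + d + H + (b + (d + h)) + 2    ≡⟨ solve (b ∷ d ∷ h ∷ H ∷ []) ⟩
    (h + H) + (2 * b + 2 * d + 2)    ≡⟨ cong (_+ (2 * b + 2 * d + 2)) h+H≡1+b+e ⟩
    suc b + e + (2 * b + 2 * d + 2)  ≡⟨ solve (b ∷ d ∷ e ∷ []) ⟩
    suc b + (suc b + d + (suc b + d + e)) ∎

  heads-balanced : Balanced (b + d + H) (b + (d + h))
  heads-balanced =
    ≤-trans (+-monoʳ-≤ (b + d) H≤1+h) (≤-reflexive (trans (+-suc (b + d) h) (cong suc (+-assoc b d h)))) ,
    ≤-trans (≤-reflexive (sym (+-assoc b d h))) (≤-trans (+-monoʳ-≤ (b + d) h≤H) (n≤1+n _))

  head-a₂ : Head K (b + d)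
  head-a₂ = ≤-trans 2≤b (m≤m+n b d) , (begin
    2 * (b + d) + 2                 ≡⟨ solve (b ∷ d ∷ []) ⟩
    suc b + d + (suc b + d + 0)     ≤⟨ +-monoʳ-≤ (suc b + d) (+-monoʳ-≤ (suc b + d) z≤n) ⟩
    suc b + d + (suc b + d + e) ∎)

  head-a₃ : Head K H
  head-a₃ = 2≤H , (begin
    2 * H + 2                  ≡⟨ solve (H ∷ []) ⟩
    H + H + 2                  ≤⟨ +-monoˡ-≤ 2 (+-monoˡ-≤ H H≤1+h) ⟩
    suc (h + H) + 2            ≡⟨ cong (λ t → suc t + 2) h+H≡1+b+e ⟩
    suc (suc b + e) + 2        ≡⟨ solve (b ∷ e ∷ []) ⟩
    2 + (b + e + 2)            ≤⟨ +-monoˡ-≤ (b + e + 2) (≤-trans 2≤b (m≤m+n b (2 * d))) ⟩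
    b + 2 * d + (b + e + 2)    ≡⟨ solve (b ∷ d ∷ e ∷ []) ⟩
    suc b + d + (suc b + d + e) ∎)
    where
    2≤H : 2 ≤ H
    2≤H = ≮⇒≥ λ H<2 → 1+n≰n {2} (begin
      3             ≤⟨ s≤s 2≤b ⟩
      suc b         ≤⟨ m≤m+n (suc b) e ⟩
      suc b + e     ≡⟨ sym h+H≡1+b+e ⟩
      h + H         ≤⟨ +-monoˡ-≤ H h≤H ⟩
      H + H         ≤⟨ +-mono-≤ (≤-pred H<2) (≤-pred H<2) ⟩
      2             ∎)

  head-b₂ : Head K b
  head-b₂ = 2≤b , (begin
    2 * b + 2        ≡⟨ solve (b ∷ []) ⟩
    suc b + suc b    ≤⟨ +-mono-≤ (m≤m+n (suc b) d) (≤-trans (m≤m+n (suc b) d) (m≤m+n (suc b + d) e)) ⟩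
    suc b + d + (suc b + d + e) ∎)

  -- The lower bound is where 14 ≤ c₁ + c₂ + c₃, i.e. (C1) at ℓ = 3, is needed.
  head-b₃ : Head K (d + h)
  head-b₃ = *-cancelˡ-≤ 2 (≤-trans 4≤2d+b+e 2d+b+e≤2[d+h]) , (begin
    2 * (d + h) + 2          ≡⟨ solve (d ∷ h ∷ []) ⟩
    2 * d + (h + h) + 2      ≤⟨ +-monoˡ-≤ 2 (+-monoʳ-≤ (2 * d) (+-monoʳ-≤ h h≤H)) ⟩
    2 * d + (h + H) + 2      ≡⟨ cong (λ t → 2 * d + t + 2) h+H≡1+b+e ⟩
    2 * d + (suc b + e) + 2  ≤⟨ +-monoʳ-≤ (2 * d + (suc b + e)) (+-monoʳ-≤ 1 (≤-trans (s≤s z≤n) 2≤b)) ⟩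
    2 * d + (suc b + e) + (1 + b) ≡⟨ solve (b ∷ d ∷ e ∷ []) ⟩
    suc b + d + (suc b + d + e) ∎)
    where
    2d+b+e≤2[d+h] : 2 * d + b + e ≤ 2 * (d + h)
    2d+b+e≤2[d+h] = +-cancelʳ-≤ 1 _ _ (begin
      2 * d + b + e + 1        ≡⟨ solve (b ∷ d ∷ e ∷ []) ⟩
      2 * d + (suc b + e)      ≡⟨ cong (2 * d +_) (sym h+H≡1+b+e) ⟩
      2 * d + (h + H)          ≤⟨ +-monoʳ-≤ (2 * d) (+-monoʳ-≤ h H≤1+h) ⟩
      2 * d + (h + suc h)      ≡⟨ solve (d ∷ h ∷ []) ⟩
      2 * (d + h) + 1          ∎)
    4≤2d+b+e : 4 ≤ 2 * d + b + e
    4≤2d+b+e = ≮⇒≥ λ 2d+b+e<4 → 1+n≰n {12} (≤-trans (n≤1+n 13) (begin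
      14                                          ≤⟨ 14≤C ⟩
      suc b + (suc b + d + (suc b + d + e))       ≡⟨ solve (b ∷ d ∷ e ∷ []) ⟩
      3 + (3 * b + 2 * d + e)                     ≤⟨ +-monoʳ-≤ 3 (m≤m+n _ (4 * d + 2 * e)) ⟩
      3 + (3 * b + 2 * d + e + (4 * d + 2 * e))   ≡⟨ solve (b ∷ d ∷ e ∷ []) ⟩
      3 + 3 * (2 * d + b + e)                     ≤⟨ +-monoʳ-≤ 3 (*-monoʳ-≤ 3 (≤-pred 2d+b+e<4)) ⟩
      12                                          ∎))

sum-of-totals : ∀ {S T A B c₁ c₂ c₃ m} → S + T + 2 ≡ c₁ + (c₂ + c₃) →
  c₁ + (c₂ + (c₃ + (A + B))) ≡ 2 * m + 2 → S + A + (T + B) ≡ 2 * m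
sum-of-totals {S} {T} {A} {B} {c₁} {c₂} {c₃} {m} heads total = +-cancelʳ-≡ 2 _ _ (begin
  S + A + (T + B) + 2                ≡⟨ solve (S ∷ A ∷ T ∷ B ∷ []) ⟩
  (S + T + 2) + (A + B)              ≡⟨ cong (_+ (A + B)) heads ⟩
  c₁ + (c₂ + c₃) + (A + B)           ≡⟨ solve (c₁ ∷ c₂ ∷ c₃ ∷ A ∷ B ∷ []) ⟩
  c₁ + (c₂ + (c₃ + (A + B)))         ≡⟨ total ⟩
  2 * m + 2                          ∎)
  where open ≡-Reasoning

both-equal-3 : ∀ {c₁ c₂} → 2 < c₁ → c₁ ≤ c₂ → c₁ + (c₂ + 0) ≡ 6 → c₁ ≡ 3 × c₂ ≡ 3
both-equal-3 {c₁} {c₂} 2<c₁ c₁≤c₂ c₁+c₂≡6 = ≤-antisym c₁≤3 2<c₁ , ≤-antisym c₂≤3 (≤-trans 2<c₁ c₁≤c₂)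
  where
  c₂≤3 : c₂ ≤ 3
  c₂≤3 = +-cancelˡ-≤ 3 c₂ 3 (begin
    3 + c₂         ≤⟨ +-monoˡ-≤ c₂ 2<c₁ ⟩
    c₁ + c₂        ≡⟨ trans (cong (c₁ +_) (sym (+-identityʳ c₂))) c₁+c₂≡6 ⟩
    6              ∎)
    where open ≤-Reasoning
  c₁≤3 : c₁ ≤ 3
  c₁≤3 = ≤-trans c₁≤c₂ c₂≤3

-- Imported only now: overloading _∷_ with the All and Pointwise constructors breaks the solve macro above.
open import Data.Nat.ListAction using (sum)
open import Data.Nat.ListAction.Properties using (sum-↭)
open import Data.List using (List; length; take; drop; map)
open import Data.List.Properties using (take-map)
open import Data.List.Relation.Unary.All as All using (All; []; _∷_)
open import Data.List.Relation.Unary.Linked as Linked using (Linked; [-]; _∷_)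
open import Data.List.Relation.Unary.Linked.Properties using (Linked⇒All)
open import Data.List.Relation.Binary.Pointwise using (Pointwise; []; _∷_)
open import Data.List.Relation.Binary.Pointwise.Properties using (Pointwise-length)
open import Data.List.Relation.Binary.Permutation.Propositional using (_↭_; ↭-sym)
open import Data.List.Relation.Binary.Permutation.Propositional.Properties using (All-resp-↭; ↭-length; map⁺)
open import Data.List.Sort ≤-decTotalOrder using (sort-↭; sort-↗)
open import Data.Bool using (true; false)
open import Relation.Nullary.Reflects using (ofʸ; ofⁿ)

-- Shortfall below a threshold

shortfall : ℕ → List ℕ → ℕ
shortfall U xs = sum (map (U ∸_) xs)

shortfall-↭ : ∀ U {xs ys} → xs ↭ ys → shortfall U xs ≡ shortfall U ys
shortfall-↭ U p = sum-↭ (map⁺ (U ∸_) p)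

ℓ*U≤sum-take+shortfall : ∀ U ℓ xs → ℓ ≤ length xs → ℓ * U ≤ sum (take ℓ xs) + shortfall U xs
ℓ*U≤sum-take+shortfall U zero    xs       _         = z≤n
ℓ*U≤sum-take+shortfall U (suc ℓ) (x ∷ xs) (s≤s ℓ≤) = begin
  U + ℓ * U
    ≤⟨ +-mono-≤ (m≤n+m∸n U x) (ℓ*U≤sum-take+shortfall U ℓ xs ℓ≤) ⟩
  (x + (U ∸ x)) + (sum (take ℓ xs) + shortfall U xs)
    ≡⟨ interchange x (U ∸ x) _ _ ⟩
  (x + sum (take ℓ xs)) + ((U ∸ x) + shortfall U xs)
    ∎
  where open ≤-Reasoning

sort-feasible : ∀ d xs → length xs ≡ d → All (1 ≤_) xs → sum xs ≡ twoSum d →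
  (∀ ℓ → 1 ≤ ℓ → ℓ ≤ d → shortfall (2 ^ ℓ) xs + twoSum ℓ ≤ ℓ * 2 ^ ℓ) →
  Feasible d (sort xs)
sort-feasible d xs len pos total threshold =
  (len′ , sort-↗ xs , All-resp-↭ (↭-sym (sort-↭ xs)) pos) , prefix , trans (sum-↭ (sort-↭ xs)) total
  where
  len′ : length (sort xs) ≡ d
  len′ = trans (↭-length (sort-↭ xs)) len
  prefix : ∀ ℓ → 1 ≤ ℓ → ℓ ≤ d → twoSum ℓ ≤ sum (take ℓ (sort xs))
  prefix ℓ 1≤ℓ ℓ≤d = +-cancelʳ-≤ (shortfall (2 ^ ℓ) xs) _ _ (begin
    twoSum ℓ + shortfall (2 ^ ℓ) xs
      ≡⟨ +-comm (twoSum ℓ) _ ⟩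
    shortfall (2 ^ ℓ) xs + twoSum ℓ
      ≤⟨ threshold ℓ 1≤ℓ ℓ≤d ⟩
    ℓ * 2 ^ ℓ
      ≤⟨ ℓ*U≤sum-take+shortfall (2 ^ ℓ) ℓ (sort xs) (subst (ℓ ≤_) (sym len′) ℓ≤d) ⟩
    sum (take ℓ (sort xs)) + shortfall (2 ^ ℓ) (sort xs)
      ≡⟨ cong (sum (take ℓ (sort xs)) +_) (shortfall-↭ (2 ^ ℓ) (sort-↭ xs)) ⟩
    sum (take ℓ (sort xs)) + shortfall (2 ^ ℓ) xs
      ∎)
    where open ≤-Reasoning

-- The greedy split of the tail

IsHalf : ℕ → ℕ → Set
IsHalf c z = ⌊ c /2⌋ ≤ z × z ≤ ⌈ c /2⌉

tailA tailB : ℕ → ℕ → List ℕ → List ℕ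
tailA sa sb r = map proj₁ (abTail sa sb r)
tailB sa sb r = map proj₂ (abTail sa sb r)

take-abTail : ∀ n sa sb r → take n (abTail sa sb r) ≡ abTail sa sb (take n r)
take-abTail zero    sa sb r       = refl
take-abTail (suc n) sa sb []      = refl
take-abTail (suc n) sa sb (c ∷ r) with sa <ᵇ sb
... | true  = cong (_ ∷_) (take-abTail n _ _ r)
... | false = cong (_ ∷_) (take-abTail n _ _ r)

abTail-halves : ∀ sa sb r → Pointwise IsHalf r (tailA sa sb r) × Pointwise IsHalf r (tailB sa sb r)
abTail-halves sa sb []      = [] , []
abTail-halves sa sb (c ∷ r) with sa <ᵇ sb
... | true  = ((⌊n/2⌋≤⌈n/2⌉ c , ≤-refl) ∷ proj₁ rest) , ((≤-refl , ⌊n/2⌋≤⌈n/2⌉ c) ∷ proj₂ rest)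
  where
  rest : Pointwise IsHalf r (tailA _ _ r) × Pointwise IsHalf r (tailB _ _ r)
  rest = abTail-halves _ _ r
... | false = ((≤-refl , ⌊n/2⌋≤⌈n/2⌉ c) ∷ proj₁ rest) , ((⌊n/2⌋≤⌈n/2⌉ c , ≤-refl) ∷ proj₂ rest)
  where
  rest : Pointwise IsHalf r (tailA _ _ r) × Pointwise IsHalf r (tailB _ _ r)
  rest = abTail-halves _ _ r

abTail-sum : ∀ sa sb r → sum (tailA sa sb r) + sum (tailB sa sb r) ≡ sum r
abTail-sum sa sb []      = refl
abTail-sum sa sb (c ∷ r) with sa <ᵇ sb
... | true  = trans (interchange ⌈ c /2⌉ _ ⌊ c /2⌋ _)
                (cong₂ _+_ (trans (+-comm ⌈ c /2⌉ _) (⌊n/2⌋+⌈n/2⌉≡n c)) (abTail-sum _ _ r))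
... | false = trans (interchange ⌊ c /2⌋ _ ⌈ c /2⌉ _) (cong₂ _+_ (⌊n/2⌋+⌈n/2⌉≡n c) (abTail-sum _ _ r))

-- The greedy rule hands the larger half to the currently smaller running sum.
abTail-balanced : ∀ sa sb r → Balanced sa sb →
  Balanced (sa + sum (tailA sa sb r)) (sb + sum (tailB sa sb r))
abTail-balanced sa sb [] bal rewrite +-identityʳ sa | +-identityʳ sb = bal
abTail-balanced sa sb (c ∷ r) (sa≤1+sb , sb≤1+sa) with sa <ᵇ sb | <ᵇ-reflects-< sa sb
... | true  | ofʸ sa<sb = subst₂ Balanced (+-assoc sa _ _) (+-assoc sb _ _)
  (abTail-balanced _ _ r (swap (balanced-step c (<⇒≤ sa<sb) sb≤1+sa)))
... | false | ofⁿ sa≮sb = subst₂ Balanced (+-assoc sa _ _) (+-assoc sb _ _)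
  (abTail-balanced _ _ r (balanced-step c (≮⇒≥ sa≮sb) sa≤1+sb))

take-tailA : ∀ n sa sb r → take n (tailA sa sb r) ≡ tailA sa sb (take n r)
take-tailA n sa sb r = trans (take-map n _) (cong (map proj₁) (take-abTail n sa sb r))

take-tailB : ∀ n sa sb r → take n (tailB sa sb r) ≡ tailB sa sb (take n r)
take-tailB n sa sb r = trans (take-map n _) (cong (map proj₂) (take-abTail n sa sb r))

prefix-balanced : ∀ {sa sb} r → Balanced sa sb → ∀ n →
  Balanced (sa + sum (take n (tailA sa sb r))) (sb + sum (take n (tailB sa sb r)))
prefix-balanced {sa} {sb} r bal n =
  subst₂ (λ as bs → Balanced (sa + sum as) (sb + sum bs)) (sym (take-tailA n sa sb r)) (sym (take-tailB n sa sb r))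
    (abTail-balanced sa sb (take n r) bal)

prefix-sum : ∀ sa sb r n → sum (take n (tailA sa sb r)) + sum (take n (tailB sa sb r)) ≡ sum (take n r)
prefix-sum sa sb r n =
  subst₂ (λ as bs → sum as + sum bs ≡ sum (take n r)) (sym (take-tailA n sa sb r)) (sym (take-tailB n sa sb r))
    (abTail-sum sa sb (take n r))

halves-positive : ∀ {r zs} → Pointwise IsHalf r zs → All (2 ≤_) r → All (1 ≤_) zs
halves-positive []                   []           = []
halves-positive ((⌊c⌋≤z , _) ∷ hs) (2≤c ∷ 2≤r) =
  ≤-trans (2*m≤n⇒m≤⌊n/2⌋ 2≤c) ⌊c⌋≤z ∷ halves-positive hs 2≤r

shortfall-halves-≥ : ∀ {U r zs} → Pointwise IsHalf r zs → All (2 * U ≤_) r → shortfall U zs ≡ 0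
shortfall-halves-≥ []                   []             = refl
shortfall-halves-≥ ((⌊c⌋≤z , _) ∷ hs) (2U≤c ∷ bigs) =
  cong₂ _+_ (m≤n⇒m∸n≡0 (≤-trans (2*m≤n⇒m≤⌊n/2⌋ 2U≤c) ⌊c⌋≤z)) (shortfall-halves-≥ hs bigs)

shortfall-halves : ∀ {U} n {r zs} → n ≤ length r → Pointwise IsHalf r zs →
  All (_< 2 * U) (take n r) → All (2 * U ≤_) (drop n r) →
  shortfall U zs + sum (take n zs) ≡ n * U
shortfall-halves zero _ hs _ bigs = trans (+-identityʳ _) (shortfall-halves-≥ hs bigs)
shortfall-halves {U} (suc n) {c ∷ r} {z ∷ zs} (s≤s n≤) ((_ , z≤⌈c⌉) ∷ hs) (c<2U ∷ smalls) bigs = begin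
  ((U ∸ z) + shortfall U zs) + (z + sum (take n zs))
    ≡⟨ interchange (U ∸ z) _ z _ ⟩
  ((U ∸ z) + z) + (shortfall U zs + sum (take n zs))
    ≡⟨ cong₂ _+_ (m∸n+n≡m z≤U) (shortfall-halves n n≤ hs smalls bigs) ⟩
  U + n * U
    ∎
  where
  open ≡-Reasoning
  z≤U : z ≤ U
  z≤U = ≤-trans z≤⌈c⌉ (n<2*m⇒⌈n/2⌉≤m c<2U)

tail-shortfall : ∀ {U S T} n {r zs ws} → n ≤ length r → Pointwise IsHalf r zs →
  All (_< 2 * U) (take n r) → All (2 * U ≤_) (drop n r) →
  Balanced (S + sum (take n zs)) (T + sum (take n ws)) →
  sum (take n zs) + sum (take n ws) ≡ sum (take n r) →
  2 * shortfall U zs + sum (take n r) + T ≤ 2 * (n * U) + S + 1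
tail-shortfall {U} n {r} {zs} {ws} n≤ hs small big (_ , T+B≤1+S+A) split =
  doubled-tail-bound (shortfall U zs) (sum (take n zs)) (sum (take n ws))
    (shortfall-halves n n≤ hs small big) split T+B≤1+S+A

sorted-split : ∀ B {r} → Linked _≤_ r →
  Σ[ n ∈ ℕ ] n ≤ length r × All (_< B) (take n r) × All (B ≤_) (drop n r)
sorted-split B {[]}    _      = 0 , z≤n , [] , []
sorted-split B {c ∷ r} sorted with B ≤? c
... | yes B≤c = 0 , z≤n , [] , Linked⇒All ≤-trans B≤c sorted
... | no  B≰c with sorted-split B (Linked.tail sorted)
...   | n , n≤ , small , big = suc n , s≤s n≤ , ≰⇒> B≰c ∷ small , big

n*m≤sum-take : ∀ {m} n {xs} → All (m ≤_) xs → n ≤ length xs → n * m ≤ sum (take n xs)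
n*m≤sum-take zero    _              _         = z≤n
n*m≤sum-take (suc n) (m≤x ∷ m≤xs) (s≤s n≤) = +-mono-≤ m≤x (n*m≤sum-take n m≤xs n≤)

head-below : ∀ {c B n r} → All (c ≤_) r → All (_< B) (take (suc n) r) → suc n ≤ length r → c < B
head-below (c≤x ∷ _) (x<B ∷ _) _ = ≤-<-trans c≤x x<B

-- The threshold bound for one new sequence, and the lemma

module Side {c₁ c₂ c₃ : ℕ} {r : List ℕ} (3≤c₁ : 3 ≤ c₁) (c₁≤c₂ : c₁ ≤ c₂) (c₂≤c₃ : c₂ ≤ c₃)
            (sorted : Linked _≤_ r) (c₃≤r : All (c₃ ≤_) r)
            (prefix : ∀ n → n ≤ length r → twoSum (3 + n) ≤ c₁ + (c₂ + (c₃ + sum (take n r)))) where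

  module _ {x y T zs ws} (hx : Head (c₂ + c₃) x) (hy : Head (c₂ + c₃) y)
           (heads : x + y + T + 2 ≡ c₁ + (c₂ + c₃)) (halves : Pointwise IsHalf r zs)
           (balanced : ∀ n → Balanced (x + y + sum (take n zs)) (T + sum (take n ws)))
           (split : ∀ n → sum (take n zs) + sum (take n ws) ≡ sum (take n r)) where

    x+y≤1+T : x + y ≤ suc T
    x+y≤1+T = subst₂ (λ s t → s ≤ suc t) (+-identityʳ (x + y)) (+-identityʳ T) (proj₁ (balanced 0))

    T≤1+x+y : T ≤ suc (x + y)
    T≤1+x+y = subst₂ (λ s t → t ≤ suc s) (+-identityʳ (x + y)) (+-identityʳ T) (proj₂ (balanced 0))

    threshold-all-above : ∀ ℓ → 1 ≤ ℓ → All (2 * 2 ^ ℓ ≤_) r →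
      shortfall (2 ^ ℓ) (x ∷ y ∷ zs) + twoSum ℓ ≤ ℓ * 2 ^ ℓ
    threshold-all-above ℓ 1≤ℓ big = begin
      (U ∸ x) + ((U ∸ y) + shortfall U zs) + twoSum ℓ
        ≡⟨ cong (λ s → (U ∸ x) + ((U ∸ y) + s) + twoSum ℓ) (shortfall-halves-≥ halves big) ⟩
      (U ∸ x) + ((U ∸ y) + 0) + twoSum ℓ
        ≡⟨ cong (λ s → (U ∸ x) + s + twoSum ℓ) (+-identityʳ (U ∸ y)) ⟩
      (U ∸ x) + (U ∸ y) + twoSum ℓ
        ≤⟨ pair-shortfall ℓ 1≤ℓ (proj₁ hx) (proj₁ hy) 6≤x+y ⟩
      ℓ * U
        ∎
      where
      open ≤-Reasoning
      U : ℕ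
      U = 2 ^ ℓ
      14≤C : 14 ≤ c₁ + (c₂ + c₃)
      14≤C = subst (λ t → 14 ≤ c₁ + (c₂ + t)) (+-identityʳ c₃) (prefix 0 z≤n)
      6≤x+y : 6 ≤ x + y
      6≤x+y = 14≤s+T+2⇒6≤s T≤1+x+y heads 14≤C

    threshold-some-below : ∀ ℓ n → suc n ≤ length r →
      All (_< 2 * 2 ^ ℓ) (take (suc n) r) → All (2 * 2 ^ ℓ ≤_) (drop (suc n) r) →
      shortfall (2 ^ ℓ) (x ∷ y ∷ zs) + twoSum ℓ ≤ ℓ * 2 ^ ℓ
    threshold-some-below ℓ n n<len small big =
      shortfall+twoSum≤ℓ*U {ℓ} {suc n} {U} {x} {y} {U ∸ x} {U ∸ y} {shortfall U zs} {x ∸ U} {y ∸ U} {T} {Sg}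
        (m∸n+n≡m+[n∸m] U x) (m∸n+n≡m+[n∸m] U y) (twoSum+2 ℓ) heads+Sg tail main
      where
      U Sg P E : ℕ
      U = 2 ^ ℓ
      Sg = sum (take (suc n) r)
      P = c₁ + (c₂ + (c₃ + Sg))
      E = 2 * ((x ∸ U) + (y ∸ U))
      heads+Sg : x + y + T + 2 + Sg ≡ P
      heads+Sg = trans (cong (_+ Sg) heads) (trans (+-assoc c₁ _ Sg) (cong (c₁ +_) (+-assoc c₂ c₃ Sg)))
      tail : 2 * shortfall U zs + Sg + T ≤ 2 * (suc n * U) + (x + y) + 1
      tail = tail-shortfall {U} {x + y} {T} (suc n) {r} {zs} {ws} n<len halves small big
        (balanced (suc n)) (split (suc n))
      c₃<2U : c₃ < 2 * U
      c₃<2U = head-below c₃≤r small n<len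
      excess : E ≡ 0 ⊎ E + 2 * U + 2 ≤ c₂ + c₃
      excess = excess-dichotomy U (proj₂ hx) (proj₂ hy)
        (2*s+2≤c₂+c₃+2*U {c₂ = c₂} {c₃} {U} x+y≤1+T heads (≤-<-trans (≤-trans c₁≤c₂ c₂≤c₃) c₃<2U))
      W≤P+2 : 2 * 2 ^ (3 + suc n) ≤ P + 2
      W≤P+2 = subst (_≤ P + 2) (twoSum+2 (3 + suc n)) (+-monoˡ-≤ 2 (prefix (suc n) n<len))
      W+E≤P+2 : 2 + suc n ≤ ℓ → 2 * 2 ^ (3 + suc n) + E ≤ P + 2
      W+E≤P+2 2+n≤ℓ with excess
      ... | inj₁ E≡0 = subst (λ e → 2 * 2 ^ (3 + suc n) + e ≤ P + 2) (sym E≡0)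
                         (subst (_≤ P + 2) (sym (+-identityʳ _)) W≤P+2)
      ... | inj₂ E+2U+2≤K = excess-within-power {suc n} {2 ^ (2 + suc n)} {U}
                              (2*2^[2+n]≤7+n*[2^[2+n]+1] (suc n) (s≤s z≤n)) (^-monoʳ-≤ 2 2+n≤ℓ)
                              3≤c₁ c₂≤c₃ (n*m≤sum-take (suc n) c₃≤r n<len) E+2U+2≤K
      main : 2 * ((4 + suc n) * U) + E ≤ 2 * (ℓ * U) + (P + 2)
      main = main-inequality ℓ (suc n) (excess≤2U {U = U} {c₂} {c₃} excess c₂≤c₃ c₃<2U) W≤P+2 W+E≤P+2

    side-threshold : ∀ ℓ → 1 ≤ ℓ → shortfall (2 ^ ℓ) (x ∷ y ∷ zs) + twoSum ℓ ≤ ℓ * 2 ^ ℓ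
    side-threshold ℓ 1≤ℓ with sorted-split (2 * 2 ^ ℓ) sorted
    ... | zero  , _     , _     , big = threshold-all-above ℓ 1≤ℓ big
    ... | suc n , n<len , small , big = threshold-some-below ℓ n n<len small big

split-feasible : ∀ b d e r → 2 ≤ b → Linked _≤_ (suc b + d + e ∷ r) →
  (∀ ℓ → 1 ≤ ℓ → ℓ ≤ 3 + length r → twoSum ℓ ≤ sum (take ℓ (suc b ∷ suc b + d ∷ suc b + d + e ∷ r))) →
  sum (suc b ∷ suc b + d ∷ suc b + d + e ∷ r) ≡ twoSum (3 + length r) →
  Feasible (2 + length r) (sort (aSeq (suc b) (suc b + d) (suc b + d + e ∷ r))) ×
  Feasible (2 + length r) (sort (bSeq (suc b) (suc b + d) (suc b + d + e ∷ r)))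
split-feasible b d e r 2≤b sorted C1 C2 =
  sort-feasible _ (b + d ∷ H ∷ tailA S T r) (cong (2 +_) (sym (Pointwise-length halvesA)))
    (Head⇒1≤ head-a₂ ∷ Head⇒1≤ head-a₃ ∷ halves-positive halvesA 2≤r)
    (trans (sym (+-assoc (b + d) H _)) (proj₁ totals))
    (λ ℓ 1≤ℓ _ → side-threshold head-a₂ head-a₃ sumA halvesA (prefix-balanced r balancedST)
       (prefix-sum S T r) ℓ 1≤ℓ) ,
  sort-feasible _ (b ∷ b₃ ∷ tailB S T r) (cong (2 +_) (sym (Pointwise-length halvesB)))
    (Head⇒1≤ head-b₂ ∷ Head⇒1≤ head-b₃′ ∷ halves-positive halvesB 2≤r)
    (trans (sym (+-assoc b b₃ _)) (proj₂ totals))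
    (λ ℓ 1≤ℓ _ → side-threshold head-b₂ head-b₃′ sumB halvesB (λ n → swap (prefix-balanced r balancedST n))
       (λ n → trans (+-comm (sum (take n (tailB S T r))) _) (prefix-sum S T r n)) ℓ 1≤ℓ)
  where
  c₁ c₂ c₃ t h H b₃ S T : ℕ
  c₁ = suc b
  c₂ = c₁ + d
  c₃ = c₂ + e
  t = c₃ + c₁ ∸ c₂
  h = ⌊ t /2⌋
  H = ⌈ t /2⌉
  b₃ = (c₂ ∸ c₁) + h
  S = b + d + H
  T = b + b₃

  t≡1+b+e : t ≡ suc b + e
  t≡1+b+e = trans (cong (_∸ c₂) (+-assoc c₂ e c₁)) (trans (m+n∸m≡n c₂ (e + c₁)) (+-comm e c₁))
  b₃≡d+h : b₃ ≡ d + h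
  b₃≡d+h = cong (_+ h) (m+n∸m≡n c₁ d)
  14≤C : 14 ≤ c₁ + (c₂ + c₃)
  14≤C = subst (λ s → 14 ≤ c₁ + (c₂ + s)) (+-identityʳ c₃) (C1 3 (s≤s z≤n) (s≤s (s≤s (s≤s z≤n))))

  open Heads {b} {d} {e} {h} {H} 2≤b (trans (⌊n/2⌋+⌈n/2⌉≡n t) t≡1+b+e) (⌊n/2⌋≤⌈n/2⌉ t) (⌈n/2⌉≤1+⌊n/2⌋ t)
    14≤C

  c₃≤r : All (c₃ ≤_) r
  c₃≤r = All.tail (Linked⇒All ≤-trans ≤-refl sorted)
  2≤r : All (2 ≤_) r
  2≤r = All.map (≤-trans (≤-trans (m≤n⇒m≤1+n 2≤b) (≤-trans (m≤m+n c₁ d) (m≤m+n c₂ e)))) c₃≤r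

  open Side (s≤s 2≤b) (m≤m+n c₁ d) (m≤m+n c₂ e) (Linked.tail sorted) c₃≤r
    (λ n n≤ → C1 (3 + n) (s≤s z≤n) (s≤s (s≤s (s≤s n≤))))

  Head⇒1≤ : ∀ {K x} → Head K x → 1 ≤ x
  Head⇒1≤ (2≤x , _) = ≤-trans (s≤s z≤n) 2≤x

  head-b₃′ : Head K b₃
  head-b₃′ = subst (Head K) (sym b₃≡d+h) head-b₃
  sumA : S + T + 2 ≡ c₁ + (c₂ + c₃)
  sumA = subst (λ v → S + (b + v) + 2 ≡ c₁ + (c₂ + c₃)) (sym b₃≡d+h) heads-sum
  sumB : T + S + 2 ≡ c₁ + (c₂ + c₃)
  sumB = trans (cong (_+ 2) (+-comm T S)) sumA
  balancedST : Balanced S T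
  balancedST = subst (λ v → Balanced S (b + v)) (sym b₃≡d+h) heads-balanced

  halvesA : Pointwise IsHalf r (tailA S T r)
  halvesA = proj₁ (abTail-halves S T r)
  halvesB : Pointwise IsHalf r (tailB S T r)
  halvesB = proj₂ (abTail-halves S T r)
  totals : S + sum (tailA S T r) ≡ twoSum (2 + length r) × T + sum (tailB S T r) ≡ twoSum (2 + length r)
  totals = balanced-halves (abTail-balanced S T r balancedST)
    (sum-of-totals {S} {T} {sum (tailA S T r)} {sum (tailB S T r)} {c₁} {c₂} {c₃} {twoSum (2 + length r)} sumA
      (trans (cong (λ s → c₁ + (c₂ + (c₃ + s))) (abTail-sum S T r)) (trans C2 (twoSum-suc (2 + length r)))))

[2]-feasible : Feasible 1 (sort (2 ∷ []))
[2]-feasible = sort-feasible 1 (2 ∷ []) refl (s≤s z≤n ∷ []) refl threshold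
  where
  threshold : ∀ ℓ → 1 ≤ ℓ → ℓ ≤ 1 → shortfall (2 ^ ℓ) (2 ∷ []) + twoSum ℓ ≤ ℓ * 2 ^ ℓ
  threshold 1 _ _ = ≤-refl
  threshold (suc (suc _)) _ (s≤s ())

lemma6 : (h c1 c2 : ℕ) (rest : List ℕ) → h ≡ length (c1 ∷ c2 ∷ rest) →
    Feasible h (c1 ∷ c2 ∷ rest) → 2 < c1 →
    Feasible (h ∸ 1) (sort (aSeq c1 c2 rest)) × Feasible (h ∸ 1) (sort (bSeq c1 c2 rest))
lemma6 _ c₁ c₂ [] refl ((_ , (c₁≤c₂ ∷ [-]) , _) , _ , total) 2<c₁ with both-equal-3 2<c₁ c₁≤c₂ total
... | refl , refl = [2]-feasible , [2]-feasible
lemma6 _ (suc b) c₂ (c₃ ∷ r) refl ((_ , (c₁≤c₂ ∷ c₂≤c₃ ∷ sorted) , _) , C1 , C2) (s≤s 2≤b)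
  with m≤n⇒∃[o]m+o≡n c₁≤c₂ | m≤n⇒∃[o]m+o≡n c₂≤c₃
... | d , refl | e , refl = split-feasible b d e r 2≤b sorted C1 C2
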